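{- Let $p$ be a prime, let $n$ be a divisor of $p-1$ with $2<n<p-1$, and let $\alpha\colon\mathbb Z_n\to\mathbb Z_p^*=\mathrm{Aut}(\mathbb Z_p)$ be a non-injective group homomorphism. Assume that $|\mathrm{Ker}(\alpha)|$ is even whenever $n$ is even. Then the semidirect product $\mathbb Z_p\rtimes_\alpha\mathbb Z_n$ is not a CI-group with respect to ternary relational structures.
   Context: A ternary relational structure on a set $V$ is a collection of subsets of $V^3$; isomorphisms are bijections mapping the collection of relations of one onto that of the other; it is a Cayley object of a group $G$ (on vertex set $G$) if its automorphism group contains the left regular representation of $G$. $G$ is a CI-group with respect to ternary relational structures if any two isomorphic Cayley ternary relational structures on $G$ are isomorphic via a group automorphism of $G$. -}

module Defs where

open import Data.Nat using (ℕ; _+_; _*_; NonZero)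
open import Data.Nat.DivMod using (_mod_)
open import Data.Fin using (Fin; toℕ)

open import Data.List using (List; length; filter; allFin)
open import Data.Bool using (Bool)
open import Data.Product using (Σ; _×_; _,_)
open import Relation.Binary.PropositionalEquality using (_≡_)
open import Relation.Nullary using (¬_)
import Function.Definitions as FD

Rel3 : Set → Set
Rel3 V = V → V → V → Bool

TRS : Set → Set₁
TRS V = Rel3 V → Set

Bijective : {A B : Set} → (A → B) → Set
Bijective f = FD.Bijective _≡_ _≡_ f

-- R' is the image of R under f, i.e. R' = f(R) = {(f x, f y, f z) | (x,y,z) ∈ R}
-- (for bijective f).
MapsTo : {V W : Set} → (V → W) → Rel3 V → Rel3 W → Set
MapsTo f R R' = ∀ x y z → R' (f x) (f y) (f z) ≡ R x y z

IsIso : {V W : Set} → (V → W) → TRS V → TRS W → Set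
IsIso f 𝓡 𝓢 =
  Bijective f
  × (∀ R → 𝓡 R → Σ _ λ R' → 𝓢 R' × MapsTo f R R')
  × (∀ R' → 𝓢 R' → Σ _ λ R → 𝓡 R × MapsTo f R R')

IsCayley : {G : Set} → (G → G → G) → TRS G → Set
IsCayley _·_ 𝓡 = ∀ g → IsIso (g ·_) 𝓡 𝓡

IsGroupAut : {G : Set} → (G → G → G) → (G → G) → Set
IsGroupAut _·_ φ = Bijective φ × (∀ g h → φ (g · h) ≡ (φ g · φ h))

IsCI-Ternary : (G : Set) → (G → G → G) → Set₁
IsCI-Ternary G _·_ =
  (𝓡 𝓢 : TRS G) → IsCayley _·_ 𝓡 → IsCayley _·_ 𝓢 →
  (Σ (G → G) λ f → IsIso f 𝓡 𝓢) →
  Σ (G → G) λ φ → IsGroupAut _·_ φ × IsIso φ 𝓡 𝓢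

IsHomZnZpStar : (n p : ℕ) .{{_ : NonZero n}} .{{_ : NonZero p}} → (Fin n → Fin p) → Set
IsHomZnZpStar n p α =
  (∀ i → ¬ (toℕ (α i) ≡ 0))
  × (∀ i j → α ((toℕ i + toℕ j) mod n) ≡ (toℕ (α i) * toℕ (α j)) mod p)

kerSize : (n p : ℕ) → (Fin n → Fin p) → ℕ
kerSize n p α = length (filter (λ i → toℕ (α i) Data.Nat.≟ 1) (allFin n))
  where import Data.Nat

SD : ℕ → ℕ → Set
SD p n = Fin p × Fin n

sdMul : (p n : ℕ) .{{_ : NonZero p}} .{{_ : NonZero n}} → (Fin n → Fin p) → SD p n → SD p n → SD p n
sdMul p n α (x , i) (y , j) =
  ((toℕ x + toℕ (α i) * toℕ y) mod p , (toℕ i + toℕ j) mod n)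

module Submission where

-- Write p - 1 = k n.  As n > 2 there is c with c ^ n ≡ 1 and c ^ 2 ≢ 1 (mod p): by Lagrange's bound on the
-- roots of x ^ (2 k) - 1, some x ∈ {1, …, 2 k + 1} has x ^ (2 k) ≢ 1, and c = x ^ k satisfies
-- c ^ n = x ^ (p - 1) ≡ 1 by Fermat.  Left multiplication by (a, j) acts on Z_p-coordinates by
-- x ↦ a + α(j) x and shifts indices by j, so for all weights s₀, s₂ the relation
-- {((x₀, i), (x₁, i + 1), (x₂, i + 2)) | s₀ x₀ + s₂ x₂ = (s₀ + s₂) x₁} is a Cayley object.  The bijection
-- (x, i) ↦ (c ^ i x, i) maps the relation with weights (1, c) onto the one with weights (c, 1).  A group
-- automorphism doing the same fixes the identity and sends (k, 0) to (k v, 0), where φ(1, 0) = (v, 0);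
-- comparing the images of the triples ((0,0), (0,1), (0,2)) and ((c+1,0), (1,1), (0,2)) then gives c v = v
-- with v ≠ 0, so c = 1, contradicting c ^ 2 ≢ 1.

open import Defs
open import Data.Nat.Base using (ℕ; NonZero)
open import Data.Nat.Primality using (Prime)
open import Data.Fin using (Fin)

module Congruence (m : ℕ) .{{_ : NonZero m}} where

  open import Data.Nat as ℕ using (zero; suc; _%_; _/_; _<_)
  import Data.Nat.Properties as ℕ
  import Data.Nat.Divisibility as ℕ
  open import Data.Nat.DivMod using (m≡m%n+[m/n]*n; m%n<n; _mod_)
  open import Data.Fin using (toℕ)
  open import Data.Fin.Properties using (toℕ<n; toℕ-injective; toℕ-fromℕ<)
  open import Data.Integer using (ℤ; +_; _+_; _-_; _*_; -_; 0ℤ; ∣_∣)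
  open import Data.Integer.Properties
    using (pos-+; pos-*; +-identityʳ; m-n≡m⊖n; ∣m⊝n∣≤m⊔n; ∣i∣≡0⇒i≡0; i-j≡0⇒i≡j; +-injective)
  open import Data.Integer.Divisibility.Signed
    using (_∣_; ∣-refl; ∣m∣n⇒∣m+n; ∣m⇒∣-m; ∣m⇒∣m*n; ∣n⇒∣m*n; ∣⇒∣ᵤ; ∣ᵤ⇒∣)
  open import Data.Integer.Tactic.RingSolver using (solve-∀)
  open import Data.Nat.Tactic.RingSolver using () renaming (solve-∀ to ℕ-solve-∀)
  open import Relation.Binary.Bundles using (Setoid)
  open import Relation.Binary.PropositionalEquality using (_≡_; refl; sym; trans; cong; cong₂; subst)
  open import Level using (0ℓ)
  open import Relation.Nullary.Decidable using (Dec; map′)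
  import Relation.Binary.Reasoning.Setoid as SetoidReasoning

  infix 4 _≈_
  record _≈_ (a b : ℕ) : Set where
    constructor mk≈
    field m∣a-b : + m ∣ + a - + b
  open _≈_ public

  ≈-refl : ∀ {a} → a ≈ a
  ≈-refl {a} = mk≈ (subst (+ m ∣_) (sym (lemma (+ a))) (∣ᵤ⇒∣ (ℕ._∣0 m)))
    where
    lemma : ∀ x → x - x ≡ 0ℤ
    lemma = solve-∀

  ≈-reflexive : ∀ {a b} → a ≡ b → a ≈ b
  ≈-reflexive refl = ≈-refl

  ≈-sym : ∀ {a b} → a ≈ b → b ≈ a
  ≈-sym {a} {b} (mk≈ d) = mk≈ (subst (+ m ∣_) (lemma (+ a) (+ b)) (∣m⇒∣-m d))
    where
    lemma : ∀ x y → - (x - y) ≡ y - x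
    lemma = solve-∀

  ≈-trans : ∀ {a b c} → a ≈ b → b ≈ c → a ≈ c
  ≈-trans {a} {b} {c} (mk≈ d) (mk≈ e) = mk≈ (subst (+ m ∣_) (lemma (+ a) (+ b) (+ c)) (∣m∣n⇒∣m+n d e))
    where
    lemma : ∀ x y z → (x - y) + (y - z) ≡ x - z
    lemma = solve-∀

  ≈-setoid : Setoid 0ℓ 0ℓ
  ≈-setoid = record
    { Carrier = ℕ ; _≈_ = _≈_
    ; isEquivalence = record { refl = ≈-refl ; sym = ≈-sym ; trans = ≈-trans } }

  module ≈-Reasoning = SetoidReasoning ≈-setoid

  +-cong : ∀ {a b c d} → a ≈ b → c ≈ d → a ℕ.+ c ≈ b ℕ.+ d
  +-cong {a} {b} {c} {d} (mk≈ x) (mk≈ y) =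
    mk≈ (subst (+ m ∣_) (trans (lemma (+ a) (+ b) (+ c) (+ d)) (sym (cong₂ _-_ (pos-+ a c) (pos-+ b d))))
                       (∣m∣n⇒∣m+n x y))
    where
    lemma : ∀ a b c d → (a - b) + (c - d) ≡ (a + c) - (b + d)
    lemma = solve-∀

  *-cong : ∀ {a b c d} → a ≈ b → c ≈ d → a ℕ.* c ≈ b ℕ.* d
  *-cong {a} {b} {c} {d} (mk≈ x) (mk≈ y) =
    mk≈ (subst (+ m ∣_) (trans (lemma (+ a) (+ b) (+ c) (+ d)) (sym (cong₂ _-_ (pos-* a c) (pos-* b d))))
                       (∣m∣n⇒∣m+n (∣m⇒∣m*n (+ c) x) (∣n⇒∣m*n (+ b) y)))
    where
    lemma : ∀ a b c d → (a - b) * c + b * (c - d) ≡ a * c - b * d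
    lemma = solve-∀

  ^-cong : ∀ {a b} k → a ≈ b → a ℕ.^ k ≈ b ℕ.^ k
  ^-cong zero    _   = ≈-refl
  ^-cong (suc k) a≈b = *-cong a≈b (^-cong k a≈b)

  +-cancelˡ : ∀ {c a b} → c ℕ.+ a ≈ c ℕ.+ b → a ≈ b
  +-cancelˡ {c} {a} {b} (mk≈ x) =
    mk≈ (subst (+ m ∣_) (trans (cong₂ _-_ (pos-+ c a) (pos-+ c b)) (lemma (+ c) (+ a) (+ b))) x)
    where
    lemma : ∀ c a b → (c + a) - (c + b) ≡ a - b
    lemma = solve-∀

  %-≈ : ∀ a → a % m ≈ a
  %-≈ a = mk≈ (subst (+ m ∣_) (trans (lemma r q (+ m)) (cong (_-_ r) (sym a≡r+qm)))
                              (∣m⇒∣-m (∣n⇒∣m*n q (∣-refl {+ m}))))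
    where
    r q : ℤ
    r = + (a % m)
    q = + (a / m)
    a≡r+qm : + a ≡ r + q * + m
    a≡r+qm = trans (cong +_ (m≡m%n+[m/n]*n a m)) (trans (pos-+ (a % m) _) (cong (_+_ r) (pos-* (a / m) m)))
    lemma : ∀ r q k → - (q * k) ≡ r - (r + q * k)
    lemma = solve-∀

  toℕ-mod-≈ : ∀ a → toℕ (a mod m) ≈ a
  toℕ-mod-≈ a = ≈-trans (≈-reflexive (toℕ-fromℕ< (m%n<n a m))) (%-≈ a)

  ∣∧<⇒≡0 : ∀ {k} → m ℕ.∣ k → k < m → k ≡ 0
  ∣∧<⇒≡0 {zero}  _   _   = refl
  ∣∧<⇒≡0 {suc k} m∣k k<m with () ← ℕ.>⇒∤ k<m m∣k

  ≈⇒≡ : ∀ {a b} → a < m → b < m → a ≈ b → a ≡ b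
  ≈⇒≡ {a} {b} a<m b<m (mk≈ d) = +-injective (i-j≡0⇒i≡j (+ a) (+ b) (∣i∣≡0⇒i≡0 ∣a-b∣≡0))
    where
    ∣a-b∣<m : ∣ + a - + b ∣ < m
    ∣a-b∣<m = subst (_< m) (cong ∣_∣ (sym (m-n≡m⊖n a b)))
                (ℕ.≤-<-trans (∣m⊝n∣≤m⊔n a b) (ℕ.⊔-lub a<m b<m))
    ∣a-b∣≡0 : ∣ + a - + b ∣ ≡ 0
    ∣a-b∣≡0 = ∣∧<⇒≡0 (∣⇒∣ᵤ d) ∣a-b∣<m

  ≈⇒%≡ : ∀ {a b} → a ≈ b → a % m ≡ b % m
  ≈⇒%≡ {a} {b} a≈b = ≈⇒≡ (m%n<n a m) (m%n<n b m) (≈-trans (%-≈ a) (≈-trans a≈b (≈-sym (%-≈ b))))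

  %≡⇒≈ : ∀ {a b} → a % m ≡ b % m → a ≈ b
  %≡⇒≈ {a} {b} e = ≈-trans (≈-sym (%-≈ a)) (≈-trans (≈-reflexive e) (%-≈ b))

  toℕ-≈-injective : {x y : Fin m} → toℕ x ≈ toℕ y → x ≡ y
  toℕ-≈-injective {x} {y} x≈y = toℕ-injective (≈⇒≡ (toℕ<n x) (toℕ<n y) x≈y)

  ∣⇒≈0 : ∀ {a} → m ℕ.∣ a → a ≈ 0
  ∣⇒≈0 {a} m∣a = mk≈ (subst (+ m ∣_) (sym (+-identityʳ (+ a))) (∣ᵤ⇒∣ m∣a))

  ≈0⇒∣ : ∀ {a} → a ≈ 0 → m ℕ.∣ a
  ≈0⇒∣ {a} (mk≈ d) = ∣⇒∣ᵤ (subst (+ m ∣_) (+-identityʳ (+ a)) d)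

  infix 4 _≈?_
  _≈?_ : ∀ a b → Dec (a ≈ b)
  a ≈? b = map′ %≡⇒≈ ≈⇒%≡ (a % m ℕ.≟ b % m)

  c+1≈0⇒c²≈1 : ∀ {c} → c ℕ.+ 1 ≈ 0 → c ℕ.* c ≈ 1
  c+1≈0⇒c²≈1 {c} c+1≈0 = begin
    c ℕ.* c                    ≡⟨ ℕ.+-identityʳ (c ℕ.* c) ⟨
    c ℕ.* c ℕ.+ 0              ≈⟨ +-cong (≈-refl {c ℕ.* c}) c+1≈0 ⟨
    c ℕ.* c ℕ.+ (c ℕ.+ 1)      ≡⟨ lemma c ⟩
    c ℕ.* (c ℕ.+ 1) ℕ.+ 1      ≈⟨ +-cong (*-cong (≈-refl {c}) c+1≈0) (≈-refl {1}) ⟩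
    c ℕ.* 0 ℕ.+ 1              ≡⟨ cong (ℕ._+ 1) (ℕ.*-zeroʳ c) ⟩
    1                          ∎
    where
    open ≈-Reasoning
    lemma : ∀ c → c ℕ.* c ℕ.+ (c ℕ.+ 1) ≡ c ℕ.* (c ℕ.+ 1) ℕ.+ 1
    lemma = ℕ-solve-∀

module PrimeCongruence (p : ℕ) .{{_ : NonZero p}} (prime : Prime p) where

  open import Data.Nat as ℕ using (zero; suc; _<_)
  import Data.Nat.Divisibility as ℕ
  open import Data.Nat.Primality using (euclidsLemma; prime⇒nonTrivial)
  open import Data.Nat.Base using (nonTrivial⇒n>1)
  open import Data.Integer using (+_; _-_; _*_; ∣_∣)
  open import Data.Integer.Properties using (abs-*; pos-*)
  open import Data.Integer.Divisibility.Signed using (_∣_; ∣⇒∣ᵤ; ∣ᵤ⇒∣)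
  open import Data.Integer.Tactic.RingSolver using (solve-∀)
  open import Data.Sum using (_⊎_; inj₁; inj₂; [_,_])
  open import Function using (_∘_)
  open import Relation.Nullary using (¬_; contradiction)
  open import Relation.Binary.PropositionalEquality using (_≡_; subst; trans; cong₂)
  open Congruence p

  euclidsLemmaℤ : ∀ x y → + p ∣ x * y → (+ p ∣ x) ⊎ (+ p ∣ y)
  euclidsLemmaℤ x y p∣xy with euclidsLemma ∣ x ∣ ∣ y ∣ prime (subst (p ℕ.∣_) (abs-* x y) (∣⇒∣ᵤ p∣xy))
  ... | inj₁ p∣x = inj₁ (∣ᵤ⇒∣ p∣x)
  ... | inj₂ p∣y = inj₂ (∣ᵤ⇒∣ p∣y)

  euclidsLemma≈ : ∀ {a b} → a ℕ.* b ≈ 0 → a ≈ 0 ⊎ b ≈ 0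
  euclidsLemma≈ {a} {b} ab≈0 = [ inj₁ ∘ ∣⇒≈0 , inj₂ ∘ ∣⇒≈0 ] (euclidsLemma a b prime (≈0⇒∣ ab≈0))

  <p⇒≉0 : ∀ {a} → 0 < a → a < p → ¬ a ≈ 0
  <p⇒≉0 {suc a} _ a<p a≈0 = ℕ.>⇒∤ a<p (≈0⇒∣ a≈0)

  1≉0 : ¬ 1 ≈ 0
  1≉0 = <p⇒≉0 ℕ.z<s (nonTrivial⇒n>1 p {{prime⇒nonTrivial prime}})

  *-≉0 : ∀ {a b} → ¬ a ≈ 0 → ¬ b ≈ 0 → ¬ a ℕ.* b ≈ 0
  *-≉0 a≉0 b≉0 ab≈0 = [ a≉0 , b≉0 ] (euclidsLemma≈ ab≈0)

  ^-≉0 : ∀ {a} → ¬ a ≈ 0 → ∀ k → ¬ a ℕ.^ k ≈ 0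
  ^-≉0 a≉0 zero    = 1≉0
  ^-≉0 a≉0 (suc k) = *-≉0 a≉0 (^-≉0 a≉0 k)

  *-cancelˡ : ∀ {a x y} → ¬ a ≈ 0 → a ℕ.* x ≈ a ℕ.* y → x ≈ y
  *-cancelˡ {a} {x} {y} a≉0 (mk≈ d) with euclidsLemmaℤ (+ a) (+ x - + y) p∣a[x-y]
    where
    lemma : ∀ a x y → a * x - a * y ≡ a * (x - y)
    lemma = solve-∀
    p∣a[x-y] : + p ∣ + a * (+ x - + y)
    p∣a[x-y] = subst (+ p ∣_) (trans (cong₂ _-_ (pos-* a x) (pos-* a y)) (lemma (+ a) (+ x) (+ y))) d
  ... | inj₁ p∣a   = contradiction (∣⇒≈0 (∣⇒∣ᵤ p∣a)) a≉0
  ... | inj₂ p∣x-y = mk≈ p∣x-y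

module Fermat (p : ℕ) .{{_ : NonZero p}} (prime : Prime p) where

  open import Data.Nat as ℕ using (zero; suc; _+_; _*_; _^_; _∸_; _<_; _!; pred)
  import Data.Nat.Properties as ℕ
  open import Data.Nat.Divisibility using (_∣_; m∣m*n; ∣m⇒∣m*n; >⇒∤; ∣1⇒≡1)
  open import Data.Nat.DivMod using (m/n*n≡m)
  open import Data.Nat.Combinatorics using (_C_; nCk≡n!/k![n-k]!; k![n∸k]!∣n!; nCn≡1)
  open import Data.Nat.Primality using (euclidsLemma; prime⇒nonTrivial)
  open import Data.Nat.Base using (nonTrivial⇒≢1)
  open import Data.Fin using (toℕ; fromℕ) renaming (zero to fzero; suc to fsuc)
  open import Data.Fin.Properties using (toℕ-fromℕ)
  open import Data.Sum using (inj₁; inj₂)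
  open import Algebra.Bundles using (CommutativeSemiring)
  import Algebra.Properties.CommutativeSemiring.Binomial as Binomial
  import Algebra.Properties.Semiring.Sum as SemiringSum
  import Algebra.Definitions.RawMonoid as RawMonoid
  import Algebra.Definitions.RawSemiring as RawSemiring
  open import Relation.Nullary using (¬_; contradiction)
  open import Relation.Binary.PropositionalEquality using (_≡_; refl; sym; trans; cong; cong₂; subst)
  open Congruence p
  open PrimeCongruence p prime using (*-cancelˡ)

  private
    ℕ-semiring : CommutativeSemiring _ _
    ℕ-semiring = ℕ.+-*-commutativeSemiring
    open CommutativeSemiring ℕ-semiring using (semiring; +-rawMonoid; rawSemiring)
    open SemiringSum semiring using (sum)
    open Binomial ℕ-semiring using (binomialTerm; theorem)

    -- The binomial theorem is stated with the multiples and powers of an arbitrary semiring, which agree with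
    -- those of ℕ only propositionally.
    infixr 8 _×ₛ_ _^ₛ_
    _×ₛ_ _^ₛ_ : ℕ → ℕ → ℕ
    _×ₛ_ = RawMonoid._×_ +-rawMonoid
    _^ₛ_ = RawSemiring._^_ rawSemiring

    ×ₛ≡* : ∀ k x → k ×ₛ x ≡ k * x
    ×ₛ≡* zero    x = refl
    ×ₛ≡* (suc k) x = cong (x +_) (×ₛ≡* k x)

    ^ₛ≡^ : ∀ x k → x ^ₛ k ≡ x ^ k
    ^ₛ≡^ x zero    = refl
    ^ₛ≡^ x (suc k) = cong (x *_) (^ₛ≡^ x k)

  p∤k! : ∀ {k} → k < p → ¬ p ∣ k !
  p∤k! {zero}  _   p∣1  = nonTrivial⇒≢1 {{prime⇒nonTrivial prime}} (∣1⇒≡1 p∣1)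
  p∤k! {suc k} k<p p∣k! with euclidsLemma (suc k) (k !) prime p∣k!
  ... | inj₁ p∣k+1 = >⇒∤ k<p p∣k+1
  ... | inj₂ p∣k!  = p∤k! (ℕ.<-trans (ℕ.n<1+n k) k<p) p∣k!

  p∣pCk : ∀ {k} → 0 < k → k < p → p ∣ p C k
  p∣pCk {k} 0<k k<p with euclidsLemma (p C k) (k ! * (p ∸ k) !) prime p∣pCk*k!*[p-k]!
    where
    instance
      k!*[p∸k]!≢0 : NonZero (k ! * (p ∸ k) !)
      k!*[p∸k]!≢0 = k ℕ.!* (p ∸ k) !≢0
    n∣n! : ∀ n .{{_ : NonZero n}} → n ∣ n !
    n∣n! (suc n) = m∣m*n (n !)
    p∣pCk*k!*[p-k]! : p ∣ (p C k) * (k ! * (p ∸ k) !)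
    p∣pCk*k!*[p-k]! = subst (p ∣_)
      (sym (trans (cong (_* (k ! * (p ∸ k) !)) (nCk≡n!/k![n-k]! (ℕ.<⇒≤ k<p)))
                  (m/n*n≡m (k![n∸k]!∣n! (ℕ.<⇒≤ k<p)))))
      (n∣n! p)
  ... | inj₁ p∣pCk = p∣pCk
  ... | inj₂ p∣k!*[p-k]! with euclidsLemma (k !) ((p ∸ k) !) prime p∣k!*[p-k]!
  ...   | inj₁ p∣k!     = contradiction p∣k! (p∤k! k<p)
  ...   | inj₂ p∣[p-k]! = contradiction p∣[p-k]! (p∤k! (ℕ.∸-monoʳ-< 0<k (ℕ.<⇒≤ k<p)))

  sum≈last : ∀ N (f : Fin (suc N) → ℕ) → (∀ i → toℕ i < N → f i ≈ 0) → sum f ≈ f (fromℕ N)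
  sum≈last zero    f _   = ≈-reflexive (ℕ.+-identityʳ (f fzero))
  sum≈last (suc N) f f≈0 =
    +-cong (f≈0 fzero ℕ.z<s) (sum≈last N (λ i → f (fsuc i)) (λ i i<N → f≈0 (fsuc i) (ℕ.s<s i<N)))

  sum≈ends : ∀ N (f : Fin (suc N) → ℕ) → 0 < N → (∀ i → 0 < toℕ i → toℕ i < N → f i ≈ 0) →
             sum f ≈ f fzero + f (fromℕ N)
  sum≈ends (suc N) f _ f≈0 = +-cong (≈-refl {f fzero})
    (sum≈last N (λ i → f (fsuc i)) (λ i i<N → f≈0 (fsuc i) ℕ.z<s (ℕ.s<s i<N)))

  freshman's-dream : ∀ a → (a + 1) ^ p ≈ 1 + a ^ p
  freshman's-dream a = begin
    (a + 1) ^ p                 ≡⟨ ^ₛ≡^ (a + 1) p ⟨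
    (a + 1) ^ₛ p                ≡⟨ theorem p a 1 ⟩
    sum term                    ≈⟨ sum≈ends p term 0<p middle≈0 ⟩
    term fzero + term (fromℕ p) ≡⟨ cong₂ _+_ first last ⟩
    1 + a ^ p                   ∎
    where
    open ≈-Reasoning
    term : Fin (suc p) → ℕ
    term = binomialTerm a 1 p
    0<p : 0 < p
    0<p = ℕ.>-nonZero⁻¹ p
    middle≈0 : ∀ i → 0 < toℕ i → toℕ i < p → term i ≈ 0
    middle≈0 i 0<i i<p = ∣⇒≈0 (subst (p ∣_) (sym (×ₛ≡* (p C toℕ i) _)) (∣m⇒∣m*n _ (p∣pCk 0<i i<p)))
    first : term fzero ≡ 1
    first = trans (×ₛ≡* 1 _) (trans (ℕ.+-identityʳ _) (trans (ℕ.*-identityˡ _) (trans (^ₛ≡^ 1 p) (ℕ.^-zeroˡ p))))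
    last : term (fromℕ p) ≡ a ^ p
    last = term[p] (toℕ (fromℕ p)) (toℕ-fromℕ p)
      where
      term[p] : ∀ k → k ≡ p → (p C k) ×ₛ (a ^ₛ k * 1 ^ₛ (p ∸ k)) ≡ a ^ p
      term[p] k refl =
        trans (×ₛ≡* (p C p) _)
              (trans (cong₂ (λ x y → x * (a ^ₛ p * 1 ^ₛ y)) (nCn≡1 p) (ℕ.n∸n≡0 p))
                     (trans (ℕ.*-identityˡ _) (trans (ℕ.*-identityʳ _) (^ₛ≡^ a p))))

  a^p≈a : ∀ a → a ^ p ≈ a
  a^p≈a zero    = ≈-reflexive (cong (0 ^_) (sym (ℕ.suc-pred p)))
  a^p≈a (suc a) = begin
    suc a ^ p   ≡⟨ cong (_^ p) (ℕ.+-comm 1 a) ⟩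
    (a + 1) ^ p ≈⟨ freshman's-dream a ⟩
    1 + a ^ p   ≈⟨ +-cong (≈-refl {1}) (a^p≈a a) ⟩
    suc a       ∎
    where open ≈-Reasoning

  a^[p∸1]≈1 : ∀ {a} → ¬ a ≈ 0 → a ^ (p ∸ 1) ≈ 1
  a^[p∸1]≈1 {a} a≉0 = *-cancelˡ a≉0 (begin
    a * a ^ pred p ≡⟨ cong (a ^_) (ℕ.suc-pred p) ⟩
    a ^ p          ≈⟨ a^p≈a a ⟩
    a              ≡⟨ ℕ.*-identityʳ a ⟨
    a * 1          ∎)
    where open ≈-Reasoning

module Polynomial where

  open import Data.Nat as ℕ using (zero; suc; _<_; _≤_)
  import Data.Nat.Properties as ℕ
  open import Data.Integer using (ℤ; +_; _+_; _-_; _*_; _^_; 0ℤ; 1ℤ)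
  open import Data.Integer.Properties using (+-identityʳ; +-assoc)
  open import Data.Integer.Divisibility.Signed using (_∣_; ∣m∣n⇒∣m-n; ∣⇒∣ᵤ)
  open import Data.Integer.Tactic.RingSolver using (solve-∀)
  open import Data.Nat.Divisibility using (>⇒∤)
  open import Data.Product using (Σ; _×_; _,_)
  open import Data.Sum using (inj₁; inj₂)
  open import Data.Empty using (⊥)
  open import Relation.Nullary using (¬_; contradiction)
  open import Relation.Binary.PropositionalEquality using (_≡_; refl; sym; trans; cong; cong₂; subst)

  -- Poly d L f: f is a polynomial function of degree ≤ d with coefficient L at x ^ d, encoded without
  -- coefficient lists through the factor theorem: for every r, f x - f r = (x - r) * g x with Poly (d - 1) L g.
  Poly : ℕ → ℤ → (ℤ → ℤ) → Set
  Poly zero    L f = ∀ x → f x ≡ L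
  Poly (suc d) L f = ∀ r → Σ (ℤ → ℤ) λ g → Poly d L g × (∀ x → f x - f r ≡ (x - r) * g x)

  Poly-raise : ∀ {d L f} → Poly d L f → Poly (suc d) 0ℤ f
  Poly-raise {zero} {L} {f} f-const r = (λ _ → 0ℤ) , (λ _ → refl) , λ x →
    trans (cong₂ _-_ (f-const x) (f-const r)) (lemma L (x - r))
    where
    lemma : ∀ L y → L - L ≡ y * 0ℤ
    lemma = solve-∀
  Poly-raise {suc d} f-poly r with g , g-poly , f-factor ← f-poly r = g , Poly-raise g-poly , f-factor

  Poly-+ : ∀ {d L L′ f f′} → Poly d L f → Poly d L′ f′ → Poly d (L + L′) (λ x → f x + f′ x)
  Poly-+ {zero}  f-poly f′-poly x = cong₂ _+_ (f-poly x) (f′-poly x)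
  Poly-+ {suc d} {f = f} {f′} f-poly f′-poly r
    with g , g-poly , f-factor ← f-poly r | g′ , g′-poly , f′-factor ← f′-poly r =
    (λ x → g x + g′ x) , Poly-+ g-poly g′-poly , λ x →
      trans (lemma₁ (f x) (f r) (f′ x) (f′ r))
            (trans (cong₂ _+_ (f-factor x) (f′-factor x)) (lemma₂ (x - r) (g x) (g′ x)))
    where
    lemma₁ : ∀ a b c d → (a + c) - (b + d) ≡ (a - b) + (c - d)
    lemma₁ = solve-∀
    lemma₂ : ∀ y u v → y * u + y * v ≡ y * (u + v)
    lemma₂ = solve-∀

  Poly-*ˡ : ∀ {d L f} k → Poly d L f → Poly d (k * L) (λ x → k * f x)
  Poly-*ˡ {zero}  k f-poly x = cong (k *_) (f-poly x)
  Poly-*ˡ {suc d} {f = f} k f-poly r with g , g-poly , f-factor ← f-poly r =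
    (λ x → k * g x) , Poly-*ˡ k g-poly , λ x →
      trans (lemma₁ k (f x) (f r)) (trans (cong (k *_) (f-factor x)) (lemma₂ k (x - r) (g x)))
    where
    lemma₁ : ∀ k a b → k * a - k * b ≡ k * (a - b)
    lemma₁ = solve-∀
    lemma₂ : ∀ k y u → k * (y * u) ≡ y * (k * u)
    lemma₂ = solve-∀

  Poly-∸-const : ∀ {d L f} k → Poly (suc d) L f → Poly (suc d) L (λ x → f x - k)
  Poly-∸-const {f = f} k f-poly r with g , g-poly , f-factor ← f-poly r =
    g , g-poly , λ x → trans (lemma (f x) (f r) k) (f-factor x)
    where
    lemma : ∀ a b k → (a - k) - (b - k) ≡ a - b
    lemma = solve-∀

  Poly-^ : ∀ d → Poly d 1ℤ (_^ d)
  Poly-^ zero    _ = refl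
  Poly-^ (suc d) r with q , q-poly , q-factor ← Poly-raise (Poly-^ d) r =
    (λ x → x ^ d + r * q x) ,
    subst (λ L → Poly d L (λ x → x ^ d + r * q x)) (lemma₀ r) (Poly-+ (Poly-^ d) (Poly-*ˡ r q-poly)) ,
    λ x → trans (lemma₁ x r (x ^ d) (r ^ d)) (trans (cong (λ y → x * x ^ d - r * x ^ d + r * y) (q-factor x))
                                                 (lemma₂ x r (x ^ d) (q x)))
    where
    lemma₀ : ∀ r → 1ℤ + r * 0ℤ ≡ 1ℤ
    lemma₀ = solve-∀
    lemma₁ : ∀ x r X R → x * X - r * R ≡ x * X - r * X + r * (X - R)
    lemma₁ = solve-∀
    lemma₂ : ∀ x r X Q → x * X - r * X + r * ((x - r) * Q) ≡ (x - r) * (X + r * Q)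
    lemma₂ = solve-∀

  module _ {p : ℕ} .{{_ : NonZero p}} (prime : Prime p) where

    open PrimeCongruence p prime using (euclidsLemmaℤ)

    lagrange : ∀ {d L f} → ¬ (+ p ∣ L) → d < p → Poly d L f →
               ∀ a → (∀ i → i ≤ d → + p ∣ f (a + + i)) → ⊥
    lagrange {zero}  p∤L _   f-const a roots = p∤L (subst (+ p ∣_) (f-const _) (roots 0 ℕ.z≤n))
    lagrange {suc d} {f = f} p∤L d<p f-poly a roots with g , g-poly , f-factor ← f-poly a =
      lagrange p∤L (ℕ.<-trans (ℕ.n<1+n d) d<p) g-poly (a + 1ℤ) g-roots
      where
      lemma : ∀ a b → (a + b) - a ≡ b
      lemma = solve-∀
      g-roots : ∀ i → i ≤ d → + p ∣ g ((a + 1ℤ) + + i)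
      g-roots i i≤d with euclidsLemmaℤ (+ suc i) (g (a + + suc i))
        (subst (+ p ∣_) (trans (f-factor (a + + suc i)) (cong (_* g (a + + suc i)) (lemma a (+ suc i))))
               (∣m∣n⇒∣m-n (roots (suc i) (ℕ.s≤s i≤d))
                          (subst (λ x → + p ∣ f x) (+-identityʳ a) (roots 0 ℕ.z≤n))))
      ... | inj₁ p∣i+1 = contradiction (∣⇒∣ᵤ p∣i+1) (>⇒∤ (ℕ.≤-<-trans (ℕ.s≤s i≤d) d<p))
      ... | inj₂ p∣g   = subst (λ x → + p ∣ g x) (sym (+-assoc a 1ℤ (+ i))) p∣g

module RootOfUnity (p : ℕ) .{{_ : NonZero p}} (prime : Prime p) where

  open import Data.Nat as ℕ using (zero; suc; _+_; _*_; _^_; _∸_; _<_; _≤_; s≤s; z≤n)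
  import Data.Nat.Properties as ℕ
  open import Data.Nat.Divisibility using (_∣_; divides)
  open import Data.Nat.Base using (nonTrivial⇒n>1)
  open import Data.Nat.Primality using (prime⇒nonTrivial)
  open import Data.Integer as ℤ using (+_; 1ℤ)
  open import Data.Integer.Properties using (pos-*)
  open import Data.Integer.Divisibility.Signed using () renaming (_∣_ to _ℤ∣_)
  open import Data.Nat.Tactic.RingSolver using (solve-∀)
  open import Function using (_∘_)
  open import Data.Fin using (toℕ; fromℕ<)
  open import Data.Fin.Properties using (toℕ-fromℕ<; ¬∀⟶∃¬; toℕ≤pred[n])
  open import Data.Product using (Σ; _×_; _,_; proj₁; proj₂)
  open import Relation.Nullary using (¬_; contradiction)
  open import Relation.Binary.PropositionalEquality using (_≡_; refl; sym; trans; cong; subst)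
  open Congruence p
  open PrimeCongruence p prime using (<p⇒≉0; 1≉0)
  open Fermat p prime using (a^[p∸1]≈1)
  open Polynomial using (Poly-^; Poly-∸-const; lagrange)

  1<p : 1 < p
  1<p = nonTrivial⇒n>1 p {{prime⇒nonTrivial prime}}

  pos-^ : ∀ x k → (+ x) ℤ.^ k ≡ + (x ^ k)
  pos-^ x zero    = refl
  pos-^ x (suc k) = trans (cong (+ x ℤ.*_) (pos-^ x k)) (sym (pos-* x (x ^ k)))

  ∃c^n≈1∧c²≉1 : ∀ {n} → n ∣ p ∸ 1 → 2 < n → Σ ℕ λ c → c ^ n ≈ 1 × ¬ c * c ≈ 1
  ∃c^n≈1∧c²≉1 {n} (divides zero p-1≡0) _ = contradiction (ℕ.m∸n≡0⇒m≤n p-1≡0) (ℕ.<⇒≱ 1<p)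
  ∃c^n≈1∧c²≉1 {n} (divides k@(suc k′) p-1≡kn) 2<n = x ^ k , c^n≈1 , c²≉1
    where
    m : ℕ
    m = k + k
    m<p-1 : m < p ∸ 1
    m<p-1 = begin-strict
      m      <⟨ ℕ.m<m+n m ℕ.z<s ⟩
      m + k  ≡⟨ lemma k ⟩
      k * 3  ≤⟨ ℕ.*-monoʳ-≤ k 2<n ⟩
      k * n  ≡⟨ p-1≡kn ⟨
      p ∸ 1  ∎
      where
      open ℕ.≤-Reasoning
      lemma : ∀ k → k + k + k ≡ k * 3
      lemma = solve-∀
    p-1<p : p ∸ 1 < p
    p-1<p = ℕ.≤-reflexive (ℕ.suc-pred p)
    P : Fin (suc m) → Set
    P i = suc (toℕ i) ^ m ≈ 1
    ¬∀P : ¬ (∀ i → P i)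
    ¬∀P ∀P = lagrange prime {f = λ y → y ℤ.^ m ℤ.- 1ℤ} (λ p∣1 → 1≉0 (mk≈ p∣1)) (ℕ.<-trans m<p-1 p-1<p)
                   (Poly-∸-const {f = ℤ._^ m} 1ℤ (Poly-^ m)) 1ℤ roots
      where
      roots : ∀ j → j ≤ m → + p ℤ∣ (1ℤ ℤ.+ + j) ℤ.^ m ℤ.- 1ℤ
      roots j j≤m = subst (λ z → + p ℤ∣ z ℤ.- 1ℤ) (sym (pos-^ (suc j) m))
                      (m∣a-b (subst P′ (toℕ-fromℕ< (s≤s j≤m)) (∀P (fromℕ< (s≤s j≤m)))))
        where
        P′ : ℕ → Set
        P′ j = suc j ^ m ≈ 1
    witness : Σ (Fin (suc m)) λ i → ¬ P i
    witness = ¬∀⟶∃¬ (suc m) P (λ i → _ ≈? 1) ¬∀P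
    i : Fin (suc m)
    i = proj₁ witness
    x : ℕ
    x = suc (toℕ i)
    x<p : x < p
    x<p = ℕ.≤-<-trans (ℕ.≤-trans (s≤s (toℕ≤pred[n] i)) m<p-1) p-1<p
    c^n≈1 : (x ^ k) ^ n ≈ 1
    c^n≈1 = subst (_≈ 1) (sym (trans (ℕ.^-*-assoc x k n) (cong (x ^_) (sym p-1≡kn)))) (a^[p∸1]≈1 (<p⇒≉0 ℕ.z<s x<p))
    c²≉1 : ¬ (x ^ k) * (x ^ k) ≈ 1
    c²≉1 = proj₂ witness ∘ subst (_≈ 1) (sym (ℕ.^-distribˡ-+-* x k k))

module FinBijection where

  open import Data.Nat using (suc)
  import Data.Nat.Properties as ℕ
  open import Data.Fin using (punchOut)
  open import Data.Fin.Properties using (any?; injective⇒≤; punchOut-injective) renaming (_≟_ to _≟ᶠ_)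
  open import Data.Product using (Σ; _,_)
  open import Function using (_∘_; _↔_; Inverse)
  open import Function.Definitions using (Injective)
  open import Relation.Nullary using (yes; no; contradiction)
  open import Relation.Binary.PropositionalEquality using (_≡_; refl; sym; trans; cong)

  Fin-injective⇒surjective : ∀ {m} (f : Fin m → Fin m) → Injective _≡_ _≡_ f → ∀ y → Σ (Fin m) λ x → f x ≡ y
  Fin-injective⇒surjective {suc m} f f-inj y with any? (λ x → f x ≟ᶠ y)
  ... | yes y∈im = y∈im
  ... | no  y∉im = contradiction (injective⇒≤ g-inj) ℕ.1+n≰n
    where
    g : Fin (suc m) → Fin m
    g x = punchOut {i = y} {j = f x} (λ y≡fx → y∉im (x , sym y≡fx))
    g-inj : Injective _≡_ _≡_ g
    g-inj = f-inj ∘ punchOut-injective {i = y} _ _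

  injective⇒bijective : ∀ {A : Set} {m} → Fin m ↔ A → (f : A → A) → Injective _≡_ _≡_ f → Bijective f
  injective⇒bijective {m = m} Fin↔A f f-inj = f-inj , surjective
    where
    open Inverse Fin↔A
    F : Fin m → Fin m
    F = from ∘ f ∘ to
    F-inj : Injective _≡_ _≡_ F
    F-inj = to-injective ∘ f-inj ∘ from-injective
      where
      to-injective : Injective _≡_ _≡_ to
      to-injective {x} {y} tx≡ty = trans (sym (strictlyInverseʳ x)) (trans (cong from tx≡ty) (strictlyInverseʳ y))
      from-injective : Injective _≡_ _≡_ from
      from-injective {x} {y} fx≡fy = trans (sym (strictlyInverseˡ x)) (trans (cong to fx≡fy) (strictlyInverseˡ y))
    surjective : ∀ y → Σ _ λ x → ∀ {z} → z ≡ x → f z ≡ y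
    surjective y with k , Fk≡from[y] ← Fin-injective⇒surjective F F-inj (from y) =
      to k , λ { refl → trans (sym (strictlyInverseˡ (f (to k)))) (trans (cong to Fk≡from[y]) (strictlyInverseˡ y)) }

module SingletonStructure where

  open import Data.Product using (Σ; _,_)
  open import Relation.Binary.PropositionalEquality using (_≡_; refl)

  singleton : {V : Set} → Rel3 V → TRS V
  singleton R R′ = R′ ≡ R

  singleton-iso : {V W : Set} {f : V → W} {R : Rel3 V} {R′ : Rel3 W} →
                  Bijective f → MapsTo f R R′ → IsIso f (singleton R) (singleton R′)
  singleton-iso {R = R} {R′} f-bij f-maps =
    f-bij , (λ { _ refl → R′ , refl , f-maps }) , (λ { _ refl → R , refl , f-maps })

  singleton-iso⇒MapsTo : {V W : Set} {f : V → W} {R : Rel3 V} {R′ : Rel3 W} →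
                         IsIso f (singleton R) (singleton R′) → MapsTo f R R′
  singleton-iso⇒MapsTo {R = R} (_ , forth , _) with R′ , refl , f-maps ← forth R refl = f-maps

module SemidirectProduct (p n : ℕ) .{{_ : NonZero p}} .{{_ : NonZero n}} (prime : Prime p)
                         (α : Fin n → Fin p) (α-hom : IsHomZnZpStar n p α) where

  open import Data.Nat as ℕ using (zero; suc; _+_; _*_; _^_; _∸_; _<_)
  import Data.Nat.Properties as ℕ
  open import Data.Nat.Divisibility using (_∣_)
  open import Data.Nat.DivMod using (_mod_; _%_; _/_; m≡m%n+[m/n]*n)
  open import Data.Nat.Tactic.RingSolver using (solve-∀)
  open import Data.Fin using (toℕ)
  open import Data.Fin.Properties using (toℕ<n; *↔×)
  open import Data.Product using (_×_; _,_; proj₁; proj₂)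
  open import Function using (_∘_; _⇔_; mk⇔; Equivalence)
  open import Relation.Nullary using (¬_; Dec; does; yes; no; contradiction)
  open import Relation.Nullary.Decidable using (map′; _×-dec_; does-⇔)
  open import Relation.Binary.PropositionalEquality using (_≡_; refl; sym; trans; cong; cong₂; module ≡-Reasoning)
  open FinBijection using (injective⇒bijective)
  open SingletonStructure
  open PrimeCongruence p prime using (*-cancelˡ; *-≉0; ^-≉0; 1≉0)

  module ℤₚ = Congruence p
  module ℤₙ = Congruence n
  open ℤₚ using () renaming (_≈_ to _≈ₚ_)
  open ℤₙ using () renaming (_≈_ to _≈ₙ_)

  G : Set
  G = SD p n

  _·_ : G → G → G
  _·_ = sdMul p n α

  αℕ : Fin n → ℕ
  αℕ i = toℕ (α i)

  -- Computations in G are done on natural-number representatives (coordinate, index), compared by _≋_.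
  ⌜_⌝ : G → ℕ × ℕ
  ⌜ x , i ⌝ = toℕ x , toℕ i

  infix 4 _≋_
  _≋_ : ℕ × ℕ → ℕ × ℕ → Set
  (x , i) ≋ (y , j) = x ≈ₚ y × i ≈ₙ j

  ≋-refl : ∀ {P} → P ≋ P
  ≋-refl = ℤₚ.≈-refl , ℤₙ.≈-refl

  ≋-reflexive : ∀ {P Q} → P ≡ Q → P ≋ Q
  ≋-reflexive refl = ≋-refl

  ≋-sym : ∀ {P Q} → P ≋ Q → Q ≋ P
  ≋-sym (x≈y , i≈j) = ℤₚ.≈-sym x≈y , ℤₙ.≈-sym i≈j

  ≋-trans : ∀ {P Q R} → P ≋ Q → Q ≋ R → P ≋ R
  ≋-trans (x≈y , i≈j) (y≈z , j≈k) = ℤₚ.≈-trans x≈y y≈z , ℤₙ.≈-trans i≈j j≈k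

  ⟨_,_⟩ : ℕ → ℕ → G
  ⟨ a , k ⟩ = a mod p , k mod n

  ⌜⟨⟩⌝ : ∀ a k → ⌜ ⟨ a , k ⟩ ⌝ ≋ (a , k)
  ⌜⟨⟩⌝ a k = ℤₚ.toℕ-mod-≈ a , ℤₙ.toℕ-mod-≈ k

  ⌜⌝-injective : ∀ {g h} → ⌜ g ⌝ ≋ ⌜ h ⌝ → g ≡ h
  ⌜⌝-injective (x≈y , i≈j) = cong₂ _,_ (ℤₚ.toℕ-≈-injective x≈y) (ℤₙ.toℕ-≈-injective i≈j)

  ⌜·⌝ : ∀ g h → ⌜ g · h ⌝ ≋ (proj₁ ⌜ g ⌝ + αℕ (proj₂ g) * proj₁ ⌜ h ⌝ ,
                             proj₂ ⌜ g ⌝ + proj₂ ⌜ h ⌝)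
  ⌜·⌝ g h = ℤₚ.toℕ-mod-≈ _ , ℤₙ.toℕ-mod-≈ _

  α≉0 : ∀ i → ¬ αℕ i ≈ₚ 0
  α≉0 i αi≈0 = proj₁ α-hom i (ℤₚ.≈⇒≡ (toℕ<n (α i)) (ℕ.>-nonZero⁻¹ p) αi≈0)

  α≈1 : ∀ {i} → toℕ i ≈ₙ 0 → αℕ i ≈ₚ 1
  α≈1 {i} i≈0 = ℤₚ.≈-sym (*-cancelˡ (α≉0 i) (begin
    αℕ i * 1                             ≡⟨ ℕ.*-identityʳ (αℕ i) ⟩
    αℕ i                                 ≡⟨ cong αℕ i≡i+i ⟩
    toℕ (α ((toℕ i + toℕ i) mod n))      ≡⟨ cong toℕ (proj₂ α-hom i i) ⟩
    toℕ ((αℕ i * αℕ i) mod p)            ≈⟨ ℤₚ.toℕ-mod-≈ _ ⟩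
    αℕ i * αℕ i                          ∎))
    where
    open ℤₚ.≈-Reasoning
    i≡i+i : i ≡ (toℕ i + toℕ i) mod n
    i≡i+i = ℤₙ.toℕ-≈-injective
      (ℤₙ.≈-trans i≈0 (ℤₙ.≈-sym (ℤₙ.≈-trans (ℤₙ.toℕ-mod-≈ _) (ℤₙ.+-cong i≈0 i≈0))))

  ·-cancelˡ : ∀ g {h h′} → g · h ≡ g · h′ → h ≡ h′
  ·-cancelˡ g {h} {h′} gh≡gh′ =
    let coords , indices = ≋-trans (≋-sym (⌜·⌝ g h)) (≋-trans (≋-reflexive (cong ⌜_⌝ gh≡gh′)) (⌜·⌝ g h′))
    in ⌜⌝-injective (*-cancelˡ (α≉0 (proj₂ g)) (ℤₚ.+-cancelˡ coords) , ℤₙ.+-cancelˡ indices)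

  ·-bijective : ∀ g → Bijective (g ·_)
  ·-bijective g = injective⇒bijective *↔× (g ·_) (·-cancelˡ g)

  ε : G
  ε = ⟨ 0 , 0 ⟩

  ·-identityʳ : ∀ g → g · ε ≡ g
  ·-identityʳ g@(x , i) = ⌜⌝-injective (≋-trans (⌜·⌝ g ε) (coord , index))
    where
    coord : toℕ x + αℕ i * toℕ (0 mod p) ≈ₚ toℕ x
    coord = ℤₚ.≈-trans
      (ℤₚ.+-cong (ℤₚ.≈-refl {toℕ x}) (ℤₚ.*-cong (ℤₚ.≈-refl {αℕ i}) (ℤₚ.toℕ-mod-≈ 0)))
      (ℤₚ.≈-reflexive (trans (cong (toℕ x +_) (ℕ.*-zeroʳ (αℕ i))) (ℕ.+-identityʳ (toℕ x))))
    index : toℕ i + toℕ (0 mod n) ≈ₙ toℕ i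
    index = ℤₙ.≈-trans (ℤₙ.+-cong (ℤₙ.≈-refl {toℕ i}) (ℤₙ.toℕ-mod-≈ 0))
                       (ℤₙ.≈-reflexive (ℕ.+-identityʳ (toℕ i)))

  does-≡⇒ : {A B : Set} (a? : Dec A) (b? : Dec B) → does a? ≡ does b? → B → A
  does-≡⇒ (yes a)  _        _  _ = a
  does-≡⇒ (no ¬a)  (no ¬b)  _  b = contradiction b ¬b

  WeightedMean : ℕ → ℕ → ℕ → ℕ → ℕ → Set
  WeightedMean s₀ s₂ x₀ x₁ x₂ = s₀ * x₀ + s₂ * x₂ ≈ₚ (s₀ + s₂) * x₁

  record Step (s₀ s₂ : ℕ) (P₀ P₁ P₂ : ℕ × ℕ) : Set where
    constructor step
    field
      index₁ : proj₂ P₁ ≈ₙ 1 + proj₂ P₀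
      index₂ : proj₂ P₂ ≈ₙ 2 + proj₂ P₀
      mean   : WeightedMean s₀ s₂ (proj₁ P₀) (proj₁ P₁) (proj₁ P₂)

  step? : ∀ s₀ s₂ P₀ P₁ P₂ → Dec (Step s₀ s₂ P₀ P₁ P₂)
  step? s₀ s₂ (x₀ , i₀) (x₁ , i₁) (x₂ , i₂) =
    map′ (λ (i₁≈ , i₂≈ , m) → step i₁≈ i₂≈ m) (λ (step i₁≈ i₂≈ m) → i₁≈ , i₂≈ , m)
         (i₁ ℤₙ.≈? 1 + i₀ ×-dec i₂ ℤₙ.≈? 2 + i₀ ×-dec s₀ * x₀ + s₂ * x₂ ℤₚ.≈? (s₀ + s₂) * x₁)

  T : ℕ → ℕ → Rel3 G
  T s₀ s₂ g₀ g₁ g₂ = does (step? s₀ s₂ ⌜ g₀ ⌝ ⌜ g₁ ⌝ ⌜ g₂ ⌝)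

  WeightedMean-cong : ∀ {s₀ s₂ x₀ x₁ x₂ y₀ y₁ y₂} → x₀ ≈ₚ y₀ → x₁ ≈ₚ y₁ → x₂ ≈ₚ y₂ →
                      WeightedMean s₀ s₂ x₀ x₁ x₂ → WeightedMean s₀ s₂ y₀ y₁ y₂
  WeightedMean-cong {s₀} {s₂} x₀≈y₀ x₁≈y₁ x₂≈y₂ mean = begin
    s₀ * _ + s₂ * _ ≈⟨ ℤₚ.+-cong (ℤₚ.*-cong (ℤₚ.≈-refl {s₀}) x₀≈y₀)
                                 (ℤₚ.*-cong (ℤₚ.≈-refl {s₂}) x₂≈y₂) ⟨
    s₀ * _ + s₂ * _ ≈⟨ mean ⟩
    (s₀ + s₂) * _   ≈⟨ ℤₚ.*-cong (ℤₚ.≈-refl {s₀ + s₂}) x₁≈y₁ ⟩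
    (s₀ + s₂) * _   ∎
    where open ℤₚ.≈-Reasoning

  Step-resp-≋ : ∀ {s₀ s₂ P₀ P₁ P₂ Q₀ Q₁ Q₂} → P₀ ≋ Q₀ → P₁ ≋ Q₁ → P₂ ≋ Q₂ →
                Step s₀ s₂ P₀ P₁ P₂ → Step s₀ s₂ Q₀ Q₁ Q₂
  Step-resp-≋ {s₀} {s₂} (x₀≈ , i₀≈) (x₁≈ , i₁≈) (x₂≈ , i₂≈) (step index₁ index₂ mean) = step
    (ℤₙ.≈-trans (ℤₙ.≈-sym i₁≈) (ℤₙ.≈-trans index₁ (ℤₙ.+-cong (ℤₙ.≈-refl {1}) i₀≈)))
    (ℤₙ.≈-trans (ℤₙ.≈-sym i₂≈) (ℤₙ.≈-trans index₂ (ℤₙ.+-cong (ℤₙ.≈-refl {2}) i₀≈)))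
    (WeightedMean-cong {s₀} {s₂} x₀≈ x₁≈ x₂≈ mean)

  WeightedMean-affine : ∀ {s₀ s₂ a b x₀ x₁ x₂} → ¬ b ≈ₚ 0 →
    WeightedMean s₀ s₂ (a + b * x₀) (a + b * x₁) (a + b * x₂) ⇔ WeightedMean s₀ s₂ x₀ x₁ x₂
  WeightedMean-affine {s₀} {s₂} {a} {b} {x₀} {x₁} {x₂} b≉0 = mk⇔
    (λ mean → *-cancelˡ b≉0 (ℤₚ.+-cancelˡ (ℤₚ.≈-trans (ℤₚ.≈-reflexive (sym (lhs s₀ s₂ a b x₀ x₂)))
                                           (ℤₚ.≈-trans mean (ℤₚ.≈-reflexive (rhs s₀ s₂ a b x₁))))))
    (λ mean → ℤₚ.≈-trans (ℤₚ.≈-reflexive (lhs s₀ s₂ a b x₀ x₂))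
                (ℤₚ.≈-trans (ℤₚ.+-cong (ℤₚ.≈-refl {(s₀ + s₂) * a}) (ℤₚ.*-cong (ℤₚ.≈-refl {b}) mean))
                            (ℤₚ.≈-reflexive (sym (rhs s₀ s₂ a b x₁)))))
    where
    lhs : ∀ s₀ s₂ a b x₀ x₂ →
          s₀ * (a + b * x₀) + s₂ * (a + b * x₂) ≡ (s₀ + s₂) * a + b * (s₀ * x₀ + s₂ * x₂)
    lhs = solve-∀
    rhs : ∀ s₀ s₂ a b x₁ → (s₀ + s₂) * (a + b * x₁) ≡ (s₀ + s₂) * a + b * ((s₀ + s₂) * x₁)
    rhs = solve-∀

  index-shift : ∀ {j i₀ i₁} k → j + i₁ ≈ₙ k + (j + i₀) ⇔ i₁ ≈ₙ k + i₀
  index-shift {j} {i₀} {i₁} k = mk⇔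
    (λ i₁≈ → ℤₙ.+-cancelˡ (ℤₙ.≈-trans i₁≈ (ℤₙ.≈-reflexive (lemma j k i₀))))
    (λ i₁≈ → ℤₙ.≈-trans (ℤₙ.+-cong (ℤₙ.≈-refl {j}) i₁≈) (ℤₙ.≈-reflexive (sym (lemma j k i₀))))
    where
    lemma : ∀ j k i → k + (j + i) ≡ j + (k + i)
    lemma = solve-∀

  Step-translate : ∀ {s₀ s₂ a b j x₀ x₁ x₂ i₀ i₁ i₂} → ¬ b ≈ₚ 0 →
    Step s₀ s₂ (a + b * x₀ , j + i₀) (a + b * x₁ , j + i₁) (a + b * x₂ , j + i₂) ⇔
    Step s₀ s₂ (x₀ , i₀) (x₁ , i₁) (x₂ , i₂)
  Step-translate {s₀} {s₂} b≉0 = mk⇔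
    (λ (step index₁ index₂ mean) → step (to (index-shift 1) index₁) (to (index-shift 2) index₂)
                                         (to (WeightedMean-affine {s₀} {s₂} b≉0) mean))
    (λ (step index₁ index₂ mean) → step (from (index-shift 1) index₁) (from (index-shift 2) index₂)
                                         (from (WeightedMean-affine {s₀} {s₂} b≉0) mean))
    where open Equivalence

  T-invariant : ∀ s₀ s₂ g → MapsTo (g ·_) (T s₀ s₂) (T s₀ s₂)
  T-invariant s₀ s₂ g g₀ g₁ g₂ = does-⇔ (mk⇔
    (to (Step-translate (α≉0 (proj₂ g))) ∘ Step-resp-≋ (⌜·⌝ g g₀) (⌜·⌝ g g₁) (⌜·⌝ g g₂))
    (Step-resp-≋ (≋-sym (⌜·⌝ g g₀)) (≋-sym (⌜·⌝ g g₁)) (≋-sym (⌜·⌝ g g₂))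
      ∘ from (Step-translate (α≉0 (proj₂ g)))))
    (step? s₀ s₂ _ _ _) (step? s₀ s₂ _ _ _)
    where open Equivalence

  T-cayley : ∀ s₀ s₂ → IsCayley _·_ (singleton (T s₀ s₂))
  T-cayley s₀ s₂ g = singleton-iso (·-bijective g) (T-invariant s₀ s₂ g)

  module _ {c : ℕ} (c^n≈1 : c ^ n ≈ₚ 1) where

    c≉0 : ¬ c ≈ₚ 0
    c≉0 c≈0 = 1≉0 (begin
      1     ≈⟨ c^n≈1 ⟨
      c ^ n ≈⟨ ℤₚ.^-cong n c≈0 ⟩
      0 ^ n ≡⟨ cong (0 ^_) (ℕ.suc-pred n) ⟨
      0     ∎)
      where open ℤₚ.≈-Reasoning

    ^-%-≈ : ∀ k → c ^ (k % n) ≈ₚ c ^ k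
    ^-%-≈ k = begin
      c ^ (k % n)                        ≡⟨ ℕ.*-identityʳ _ ⟨
      c ^ (k % n) * 1                    ≡⟨ cong (c ^ (k % n) *_) (ℕ.^-zeroˡ (k / n)) ⟨
      c ^ (k % n) * 1 ^ (k / n)          ≈⟨ ℤₚ.*-cong (ℤₚ.≈-refl {c ^ (k % n)}) (ℤₚ.^-cong (k / n) c^n≈1) ⟨
      c ^ (k % n) * (c ^ n) ^ (k / n)    ≡⟨ cong (c ^ (k % n) *_) (ℕ.^-*-assoc c n (k / n)) ⟩
      c ^ (k % n) * c ^ (n * (k / n))    ≡⟨ ℕ.^-distribˡ-+-* c (k % n) _ ⟨
      c ^ (k % n + n * (k / n))          ≡⟨ cong (λ e → c ^ (k % n + e)) (ℕ.*-comm n (k / n)) ⟩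
      c ^ (k % n + k / n * n)            ≡⟨ cong (c ^_) (m≡m%n+[m/n]*n k n) ⟨
      c ^ k                              ∎
      where open ℤₚ.≈-Reasoning

    ^-≈ₙ : ∀ {i j} → i ≈ₙ j → c ^ i ≈ₚ c ^ j
    ^-≈ₙ {i} {j} i≈j = begin
      c ^ i       ≈⟨ ^-%-≈ i ⟨
      c ^ (i % n) ≡⟨ cong (c ^_) (ℤₙ.≈⇒%≡ i≈j) ⟩
      c ^ (j % n) ≈⟨ ^-%-≈ j ⟩
      c ^ j       ∎
      where open ℤₚ.≈-Reasoning

    WeightedMean-swap : ∀ {u x₀ x₁ x₂} → ¬ u ≈ₚ 0 →
      WeightedMean c 1 (u * x₀) (c * u * x₁) (c * (c * u) * x₂) ⇔ WeightedMean 1 c x₀ x₁ x₂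
    WeightedMean-swap {u} {x₀} {x₁} {x₂} u≉0 = mk⇔
      (λ mean → *-cancelˡ cu≉0 (ℤₚ.≈-trans (ℤₚ.≈-reflexive (sym (lhs c u x₀ x₂)))
                                            (ℤₚ.≈-trans mean (ℤₚ.≈-reflexive (rhs c u x₁)))))
      (λ mean → ℤₚ.≈-trans (ℤₚ.≈-reflexive (lhs c u x₀ x₂))
                  (ℤₚ.≈-trans (ℤₚ.*-cong (ℤₚ.≈-refl {c * u}) mean) (ℤₚ.≈-reflexive (sym (rhs c u x₁)))))
      where
      cu≉0 : ¬ c * u ≈ₚ 0
      cu≉0 = *-≉0 c≉0 u≉0
      lhs : ∀ c u x₀ x₂ → c * (u * x₀) + 1 * (c * (c * u) * x₂) ≡ c * u * (1 * x₀ + c * x₂)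
      lhs = solve-∀
      rhs : ∀ c u x₁ → (c + 1) * (c * u * x₁) ≡ c * u * ((1 + c) * x₁)
      rhs = solve-∀

    Step-scale : ∀ {x₀ x₁ x₂ i₀ i₁ i₂} →
      Step c 1 (c ^ i₀ * x₀ , i₀) (c ^ i₁ * x₁ , i₁) (c ^ i₂ * x₂ , i₂) ⇔
      Step 1 c (x₀ , i₀) (x₁ , i₁) (x₂ , i₂)
    Step-scale {x₀} {x₁} {x₂} {i₀} = mk⇔
      (λ (step index₁ index₂ mean) → step index₁ index₂
        (to (WeightedMean-swap c^i₀≉0) (WeightedMean-cong {c} {1} ℤₚ.≈-refl (scale index₁) (scale index₂) mean)))
      (λ (step index₁ index₂ mean) → step index₁ index₂
        (WeightedMean-cong {c} {1} ℤₚ.≈-refl (ℤₚ.≈-sym (scale index₁)) (ℤₚ.≈-sym (scale index₂))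
          (from (WeightedMean-swap c^i₀≉0) mean)))
      where
      open Equivalence
      c^i₀≉0 : ¬ c ^ i₀ ≈ₚ 0
      c^i₀≉0 = ^-≉0 c≉0 i₀
      scale : ∀ {k i x} → i ≈ₙ k + i₀ → c ^ i * x ≈ₚ c ^ (k + i₀) * x
      scale i≈ = ℤₚ.*-cong (^-≈ₙ i≈) ℤₚ.≈-refl

    twist : G → G
    twist (x , i) = (c ^ toℕ i * toℕ x) mod p , i

    ⌜twist⌝ : ∀ g → ⌜ twist g ⌝ ≋ (c ^ proj₂ ⌜ g ⌝ * proj₁ ⌜ g ⌝ , proj₂ ⌜ g ⌝)
    ⌜twist⌝ g = ℤₚ.toℕ-mod-≈ _ , ℤₙ.≈-refl

    twist-injective : ∀ {g g′} → twist g ≡ twist g′ → g ≡ g′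
    twist-injective {g} {g′} twist-g≡twist-g′ =
      let coords , indices =
            ≋-trans (≋-sym (⌜twist⌝ g)) (≋-trans (≋-reflexive (cong ⌜_⌝ twist-g≡twist-g′)) (⌜twist⌝ g′))
      in ⌜⌝-injective (*-cancelˡ (^-≉0 c≉0 (proj₂ ⌜ g ⌝))
                         (ℤₚ.≈-trans coords (ℤₚ.*-cong (^-≈ₙ (ℤₙ.≈-sym indices)) ℤₚ.≈-refl)) , indices)

    twist-maps : MapsTo twist (T 1 c) (T c 1)
    twist-maps g₀ g₁ g₂ = does-⇔ (mk⇔
      (to Step-scale ∘ Step-resp-≋ (⌜twist⌝ g₀) (⌜twist⌝ g₁) (⌜twist⌝ g₂))
      (Step-resp-≋ (≋-sym (⌜twist⌝ g₀)) (≋-sym (⌜twist⌝ g₁)) (≋-sym (⌜twist⌝ g₂)) ∘ from Step-scale))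
      (step? c 1 _ _ _) (step? 1 c _ _ _)
      where open Equivalence

    twist-iso : IsIso twist (singleton (T 1 c)) (singleton (T c 1))
    twist-iso = singleton-iso (injective⇒bijective *↔× twist twist-injective) twist-maps

  t o₁ o₂ : G
  t  = ⟨ 1 , 0 ⟩
  o₁ = ⟨ 0 , 1 ⟩
  o₂ = ⟨ 0 , 2 ⟩

  ⟨1,1⟩≡t·o₁ : ⟨ 1 , 1 ⟩ ≡ t · o₁
  ⟨1,1⟩≡t·o₁ = ⌜⌝-injective (≋-trans (⌜⟨⟩⌝ 1 1) (≋-sym (≋-trans (⌜·⌝ t o₁) (coord , index))))
    where
    coord : toℕ (1 mod p) + αℕ (0 mod n) * toℕ (0 mod p) ≈ₚ 1
    coord = ℤₚ.+-cong (ℤₚ.toℕ-mod-≈ 1) (ℤₚ.*-cong (α≈1 (ℤₙ.toℕ-mod-≈ 0)) (ℤₚ.toℕ-mod-≈ 0))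
    index : toℕ (0 mod n) + toℕ (1 mod n) ≈ₙ 1
    index = ℤₙ.+-cong (ℤₙ.toℕ-mod-≈ 0) (ℤₙ.toℕ-mod-≈ 1)

  ⟨1+k,0⟩≡⟨k,0⟩·t : ∀ k → ⟨ suc k , 0 ⟩ ≡ ⟨ k , 0 ⟩ · t
  ⟨1+k,0⟩≡⟨k,0⟩·t k =
    ⌜⌝-injective (≋-trans (⌜⟨⟩⌝ (suc k) 0) (≋-sym (≋-trans (⌜·⌝ ⟨ k , 0 ⟩ t) (coord , index))))
    where
    coord : toℕ (k mod p) + αℕ (0 mod n) * toℕ (1 mod p) ≈ₚ suc k
    coord = ℤₚ.≈-trans
      (ℤₚ.+-cong (ℤₚ.toℕ-mod-≈ k) (ℤₚ.*-cong (α≈1 (ℤₙ.toℕ-mod-≈ 0)) (ℤₚ.toℕ-mod-≈ 1)))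
      (ℤₚ.≈-reflexive (ℕ.+-comm k 1))
    index : toℕ (0 mod n) + toℕ (0 mod n) ≈ₙ 0
    index = ℤₙ.+-cong (ℤₙ.toℕ-mod-≈ 0) (ℤₙ.toℕ-mod-≈ 0)

  module NoAutomorphism {c : ℕ} (c²≉1 : ¬ c * c ≈ₚ 1)
                        (φ : G → G) (φ-aut : IsGroupAut _·_ φ) (φ-maps : MapsTo φ (T 1 c) (T c 1)) where

    φ-injective : ∀ {g h} → φ g ≡ φ h → g ≡ h
    φ-injective = proj₁ (proj₁ φ-aut)

    φ-hom : ∀ g h → φ (g · h) ≡ φ g · φ h
    φ-hom = proj₂ φ-aut

    φ-ε : φ ε ≡ ε
    φ-ε = sym (·-cancelˡ (φ ε) (begin
      φ ε · ε     ≡⟨ ·-identityʳ (φ ε) ⟩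
      φ ε         ≡⟨ cong φ (·-identityʳ ε) ⟨
      φ (ε · ε)   ≡⟨ φ-hom ε ε ⟩
      φ ε · φ ε   ∎))
      where open ≡-Reasoning

    ⌜φε⌝ : ⌜ φ ε ⌝ ≋ (0 , 0)
    ⌜φε⌝ = ≋-trans (≋-reflexive (cong ⌜_⌝ φ-ε)) (⌜⟨⟩⌝ 0 0)

    ⌜φ·⌝ : ∀ g h → ⌜ φ (g · h) ⌝ ≋ (proj₁ ⌜ φ g ⌝ + αℕ (proj₂ (φ g)) * proj₁ ⌜ φ h ⌝ ,
                                     proj₂ ⌜ φ g ⌝ + proj₂ ⌜ φ h ⌝)
    ⌜φ·⌝ g h = ≋-trans (≋-reflexive (cong ⌜_⌝ (φ-hom g h))) (⌜·⌝ (φ g) (φ h))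

    φ-Step : ∀ {g₀ g₁ g₂ P₀ P₁ P₂} → ⌜ g₀ ⌝ ≋ P₀ → ⌜ g₁ ⌝ ≋ P₁ → ⌜ g₂ ⌝ ≋ P₂ →
             Step 1 c P₀ P₁ P₂ → Step c 1 ⌜ φ g₀ ⌝ ⌜ φ g₁ ⌝ ⌜ φ g₂ ⌝
    φ-Step {g₀} {g₁} {g₂} g₀≋ g₁≋ g₂≋ =
      does-≡⇒ (step? c 1 _ _ _) (step? 1 c _ _ _) (φ-maps g₀ g₁ g₂)
      ∘ Step-resp-≋ (≋-sym g₀≋) (≋-sym g₁≋) (≋-sym g₂≋)

    v s₁ s₂ : ℕ
    v  = proj₁ ⌜ φ t ⌝
    s₁ = proj₁ ⌜ φ o₁ ⌝
    s₂ = proj₁ ⌜ φ o₂ ⌝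

    through-ε : Step c 1 (0 , 0) ⌜ φ o₁ ⌝ ⌜ φ o₂ ⌝
    through-ε = Step-resp-≋ ⌜φε⌝ ≋-refl ≋-refl
      (φ-Step (⌜⟨⟩⌝ 0 0) (⌜⟨⟩⌝ 0 1) (⌜⟨⟩⌝ 0 2)
              (step ℤₙ.≈-refl ℤₙ.≈-refl (ℤₚ.≈-reflexive (lemma c))))
      where
      lemma : ∀ c → 1 * 0 + c * 0 ≡ (1 + c) * 0
      lemma = solve-∀

    s₂≈[c+1]s₁ : s₂ ≈ₚ (c + 1) * s₁
    s₂≈[c+1]s₁ = ℤₚ.≈-trans (ℤₚ.≈-reflexive (lemma c s₂)) (Step.mean through-ε)
      where
      lemma : ∀ c s → s ≡ c * 0 + 1 * s
      lemma = solve-∀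

    through-⟨c+1,0⟩ : Step c 1 ⌜ φ ⟨ c + 1 , 0 ⟩ ⌝ ⌜ φ ⟨ 1 , 1 ⟩ ⌝ ⌜ φ o₂ ⌝
    through-⟨c+1,0⟩ =
      φ-Step (⌜⟨⟩⌝ (c + 1) 0) (⌜⟨⟩⌝ 1 1) (⌜⟨⟩⌝ 0 2)
             (step ℤₙ.≈-refl ℤₙ.≈-refl (ℤₚ.≈-reflexive (lemma c)))
      where
      lemma : ∀ c → 1 * (c + 1) + c * 0 ≡ (1 + c) * 1
      lemma = solve-∀

    index-⟨1,1⟩ : proj₂ ⌜ φ ⟨ 1 , 1 ⟩ ⌝ ≈ₙ 1
    index-⟨1,1⟩ = ℤₙ.≈-trans (Step.index₁ through-⟨c+1,0⟩) (ℤₙ.+-cong (ℤₙ.≈-refl {1}) index-⟨c+1,0⟩)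
      where
      index-⟨c+1,0⟩ : proj₂ ⌜ φ ⟨ c + 1 , 0 ⟩ ⌝ ≈ₙ 0
      index-⟨c+1,0⟩ =
        ℤₙ.+-cancelˡ {2} (ℤₙ.≈-trans (ℤₙ.≈-sym (Step.index₂ through-⟨c+1,0⟩)) (Step.index₂ through-ε))

    ⌜φ⟨1,1⟩⌝ : ⌜ φ ⟨ 1 , 1 ⟩ ⌝ ≋ (v + αℕ (proj₂ (φ t)) * s₁ , proj₂ ⌜ φ t ⌝ + proj₂ ⌜ φ o₁ ⌝)
    ⌜φ⟨1,1⟩⌝ = ≋-trans (≋-reflexive (cong (λ g → ⌜ φ g ⌝) ⟨1,1⟩≡t·o₁)) (⌜φ·⌝ t o₁)

    index-t : proj₂ ⌜ φ t ⌝ ≈ₙ 0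
    index-t = ℤₙ.+-cancelˡ {1} (begin
      1 + proj₂ ⌜ φ t ⌝                 ≡⟨ ℕ.+-comm 1 _ ⟩
      proj₂ ⌜ φ t ⌝ + 1                 ≈⟨ ℤₙ.+-cong ℤₙ.≈-refl (Step.index₁ through-ε) ⟨
      proj₂ ⌜ φ t ⌝ + proj₂ ⌜ φ o₁ ⌝    ≈⟨ proj₂ ⌜φ⟨1,1⟩⌝ ⟨
      proj₂ ⌜ φ ⟨ 1 , 1 ⟩ ⌝             ≈⟨ index-⟨1,1⟩ ⟩
      1                                 ∎)
      where open ℤₙ.≈-Reasoning

    coord-⟨1,1⟩ : proj₁ ⌜ φ ⟨ 1 , 1 ⟩ ⌝ ≈ₚ v + s₁
    coord-⟨1,1⟩ = ℤₚ.≈-trans (proj₁ ⌜φ⟨1,1⟩⌝)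
      (ℤₚ.≈-trans (ℤₚ.+-cong (ℤₚ.≈-refl {v}) (ℤₚ.*-cong (α≈1 index-t) (ℤₚ.≈-refl {s₁})))
                  (ℤₚ.≈-reflexive (cong (v +_) (ℕ.*-identityˡ s₁))))

    ⌜φ⟨k,0⟩⌝ : ∀ k → ⌜ φ ⟨ k , 0 ⟩ ⌝ ≋ (k * v , 0)
    ⌜φ⟨k,0⟩⌝ zero    = ⌜φε⌝
    ⌜φ⟨k,0⟩⌝ (suc k) = ≋-trans (≋-reflexive (cong (λ g → ⌜ φ g ⌝) (⟨1+k,0⟩≡⟨k,0⟩·t k)))
                             (≋-trans (⌜φ·⌝ ⟨ k , 0 ⟩ t) (coord , ℤₙ.+-cong (proj₂ (⌜φ⟨k,0⟩⌝ k)) index-t))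
      where
      coord : proj₁ ⌜ φ ⟨ k , 0 ⟩ ⌝ + αℕ (proj₂ (φ ⟨ k , 0 ⟩)) * v ≈ₚ suc k * v
      coord = ℤₚ.≈-trans
        (ℤₚ.+-cong (proj₁ (⌜φ⟨k,0⟩⌝ k)) (ℤₚ.*-cong (α≈1 (proj₂ (⌜φ⟨k,0⟩⌝ k))) (ℤₚ.≈-refl {v})))
        (ℤₚ.≈-reflexive (lemma k v))
        where
        lemma : ∀ k v → k * v + 1 * v ≡ suc k * v
        lemma = solve-∀

    cv≈v : c * v ≈ₚ v
    cv≈v = *-cancelˡ (c²≉1 ∘ ℤₚ.c+1≈0⇒c²≈1 {c}) (ℤₚ.+-cancelˡ {(c + 1) * s₁} (begin
      (c + 1) * s₁ + (c + 1) * (c * v)          ≡⟨ lemma₁ c v s₁ ⟩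
      c * ((c + 1) * v) + 1 * ((c + 1) * s₁)     ≈⟨ ℤₚ.+-cong (ℤₚ.*-cong (ℤₚ.≈-refl {c}) (proj₁ (⌜φ⟨k,0⟩⌝ (c + 1))))
                                                              (ℤₚ.*-cong (ℤₚ.≈-refl {1}) s₂≈[c+1]s₁) ⟨
      c * proj₁ ⌜ φ ⟨ c + 1 , 0 ⟩ ⌝ + 1 * s₂      ≈⟨ Step.mean through-⟨c+1,0⟩ ⟩
      (c + 1) * proj₁ ⌜ φ ⟨ 1 , 1 ⟩ ⌝             ≈⟨ ℤₚ.*-cong (ℤₚ.≈-refl {c + 1}) coord-⟨1,1⟩ ⟩
      (c + 1) * (v + s₁)                          ≡⟨ lemma₂ c v s₁ ⟩
      (c + 1) * s₁ + (c + 1) * v                  ∎))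
      where
      open ℤₚ.≈-Reasoning
      lemma₁ : ∀ c v s → (c + 1) * s + (c + 1) * (c * v) ≡ c * ((c + 1) * v) + 1 * ((c + 1) * s)
      lemma₁ = solve-∀
      lemma₂ : ∀ c v s → (c + 1) * (v + s) ≡ (c + 1) * s + (c + 1) * v
      lemma₂ = solve-∀

    v≉0 : ¬ v ≈ₚ 0
    v≉0 v≈0 = 1≉0 (proj₁ (≋-trans (≋-sym (⌜⟨⟩⌝ 1 0)) (≋-trans (≋-reflexive (cong ⌜_⌝ t≡ε)) (⌜⟨⟩⌝ 0 0))))
      where
      t≡ε : t ≡ ε
      t≡ε = φ-injective (trans (⌜⌝-injective (≋-trans (v≈0 , index-t) (≋-sym (⌜⟨⟩⌝ 0 0)))) (sym φ-ε))

    c≈1 : c ≈ₚ 1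
    c≈1 = *-cancelˡ v≉0 (begin
      v * c ≡⟨ ℕ.*-comm v c ⟩
      c * v ≈⟨ cv≈v ⟩
      v     ≡⟨ ℕ.*-identityʳ v ⟨
      v * 1 ∎)
      where open ℤₚ.≈-Reasoning

  no-automorphism : ∀ {c} → ¬ c * c ≈ₚ 1 → ∀ φ → IsGroupAut _·_ φ → ¬ MapsTo φ (T 1 c) (T c 1)
  no-automorphism {c} c²≉1 φ φ-aut φ-maps = c²≉1 (ℤₚ.*-cong c≈1 c≈1)
    where open NoAutomorphism {c} c²≉1 φ φ-aut φ-maps using (c≈1)

  ¬CI : n ∣ p ∸ 1 → 2 < n → ¬ IsCI-Ternary G _·_
  ¬CI n∣p-1 2<n isCI =
    let c , c^n≈1 , c²≉1 = RootOfUnity.∃c^n≈1∧c²≉1 p prime n∣p-1 2<n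
        φ , φ-aut , φ-iso = isCI (singleton (T 1 c)) (singleton (T c 1)) (T-cayley 1 c) (T-cayley c 1)
                                 (twist c^n≈1 , twist-iso c^n≈1)
    in no-automorphism {c} c²≉1 φ φ-aut (singleton-iso⇒MapsTo φ-iso)

open import Data.Nat using (_<_; _∸_)
open import Data.Nat.Divisibility using (_∣_)
open import Relation.Nullary using (¬_)
open import Relation.Binary.PropositionalEquality using (_≡_)
import Function.Definitions as FD

-- The construction works for every homomorphism α: non-injectivity, n < p - 1 and the kernel condition are unused.
corollary7p3 : (p n : ℕ) .{{_ : NonZero p}} .{{_ : NonZero n}} → Prime p → n ∣ p ∸ 1 → 2 < n → n < p ∸ 1 →
    (α : Fin n → Fin p) → IsHomZnZpStar n p α → ¬ FD.Injective _≡_ _≡_ α →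
    (2 ∣ n → 2 ∣ kerSize n p α) →
    ¬ IsCI-Ternary (SD p n) (sdMul p n α)
corollary7p3 p n p-prime n∣p-1 2<n _ α α-hom _ _ = SemidirectProduct.¬CI p n p-prime α α-hom n∣p-1 2<n
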